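{- Let $T$ be a $\Delta(1,2,2)$-free tournament and let $uv\in E(T)$. Let $\tilde T$ be the tournament obtained from $T$ by applying a $P_7^-$-join to $uv$, and let $(A_1,A_2)$ be the homogeneous pair of $\tilde T$ created by this operation ($A_1=D_2$ replacing $u$, $A_2=D_1$ replacing $v$). Then $\tilde T$ is $\Delta(1,2,2)$-free and $(A_1,A_2)$ is not nested if and only if $uv$ is a bridge of $T$.
   Context: Tournaments are finite; $uv\in E(T)$ means directed from $u$ to $v$; $T$ is $S$-free if no induced subtournament is isomorphic to $S$. $X\Rightarrow Y$: all edges between disjoint $X,Y$ go from $X$ to $Y$. $\Delta(1,2,2)$: vertices $x,y_1,y_2,z_1,z_2$ with $x\Rightarrow\{y_1,y_2\}\Rightarrow\{z_1,z_2\}\Rightarrow x$ and edges $y_1y_2,z_1z_2$. $P_7$: vertices $v_1,\dots,v_7$, $v_iv_j\in E$ iff $j-i\equiv1,2,4\pmod7$; $P_7^-$: $P_7$ minus a vertex; degree partition of $P_7^-$: $(D_1,D_2)$ with $D_1$ the vertices of out-degree $3$, $D_2$ those of out-degree $2$. $P_7^-$-join to $uv$: replace $u,v$ by a copy $S$ of $P_7^-$ with degree partition $(D_1,D_2)$; the new tournament induces $S$ on $V(S)$ and $T\setminus\{u,v\}$ on the rest, and each $w\in V(T)\setminus\{u,v\}$ is joined to all of $D_2$ in the same direction as to $u$ and to all of $D_1$ in the same direction as to $v$. A pair $(A_1,A_2)$ of $\tilde T$ with $A_1\cup A_2$ inducing $P_7^-$ is nested if there is $X\subseteq V(\tilde T)$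 with $A_1\cup A_2\subseteq X$ and $\tilde T[X]$ isomorphic to $P_7$. For an ordering $\sigma=(v_1,\dots,v_n)$, $B_\sigma(T)$ is the undirected graph with edges $v_iv_j$ for $i>j$, $v_iv_j\in E(T)$. An edge $uv\in E(T)$ is a bridge if for some ordering $\sigma=(v_1,\dots,v_n)$ with $u=v_i$, $v=v_j$, $i>j$, the edge $uv$ is isolated in $B_\sigma(T)$ and the edges of $B_\sigma(T)$ between $\{v_s:s<i\}$ and $\{v_t:t>i\}$, and between $\{v_s:s<j\}$ and $\{v_t:t>j\}$, form matchings. -}

module Defs where

open import Data.Nat using (ℕ; zero; suc; _+_; _∸_; _%_; _≡ᵇ_)
open import Data.Bool using (Bool; true; false; if_then_else_; not; _∧_; T)
open import Data.Fin using (Fin; toℕ; _<_; _≟_) renaming (suc to fsuc; zero to fzero)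
open import Data.List using (List; map; allFin)
open import Data.Nat.ListAction using (sum)
open import Data.Product using (Σ; _×_; _,_; ∃; proj₁)
open import Data.Sum using (_⊎_; inj₁; inj₂)
open import Relation.Binary.PropositionalEquality using (_≡_; _≢_)
open import Relation.Nullary using (¬_)
open import Relation.Nullary.Decidable using (⌊_⌋)
open import Function.Definitions using (Injective)

Adj : Set → Set
Adj V = V → V → Bool

IsTournament : {V : Set} → Adj V → Set
IsTournament {V} adj =
  (∀ x → adj x x ≡ false) × (∀ x y → x ≢ y → adj x y ≡ not (adj y x))

Contains : {V : Set} {k : ℕ} → Adj V → Adj (Fin k) → Set
Contains {V} {k} adj S =
  Σ (Fin k → V) λ f → Injective _≡_ _≡_ f × (∀ i j → adj (f i) (f j) ≡ S i j)

Free : {V : Set} {k : ℕ} → Adj V → Adj (Fin k) → Set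
Free adj S = ¬ Contains adj S

-- Δ(1,2,2): x = 0, y₁ = 1, y₂ = 2, z₁ = 3, z₂ = 4.

Δℕ : ℕ → ℕ → Bool
Δℕ 0 1 = true
Δℕ 0 2 = true
Δℕ 1 3 = true
Δℕ 1 4 = true
Δℕ 2 3 = true
Δℕ 2 4 = true
Δℕ 3 0 = true
Δℕ 4 0 = true
Δℕ 1 2 = true
Δℕ 3 4 = true
Δℕ _ _ = false

Δ122 : Adj (Fin 5)
Δ122 i j = Δℕ (toℕ i) (toℕ j)

-- P₇ on Fin 7 (v_{i+1} ↦ i):  ij is an edge iff j - i ≡ 1, 2, 4 (mod 7).

isQR : ℕ → Bool
isQR 1 = true
isQR 2 = true
isQR 4 = true
isQR _ = false

P7 : Adj (Fin 7)
P7 i j = isQR ((toℕ j + 7 ∸ toℕ i) % 7)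

-- P₇⁻ : P₇ minus the vertex 0 (P₇ is vertex-transitive); index i ↦ vertex i+1.
P7⁻ : Adj (Fin 6)
P7⁻ i j = P7 (fsuc i) (fsuc j)

outdeg⁻ : Fin 6 → ℕ
outdeg⁻ i = sum (map (λ j → if P7⁻ i j then 1 else 0) (allFin 6))

-- membership in D₂ (out-degree 2); the others have out-degree 3 (D₁).
inD₂ : Fin 6 → Bool
inD₂ i = outdeg⁻ i ≡ᵇ 2

Rest : {n : ℕ} → Fin n → Fin n → Set
Rest {n} u v = Σ (Fin n) λ w → T (not ⌊ w ≟ u ⌋ ∧ not ⌊ w ≟ v ⌋)

JoinV : {n : ℕ} → Fin n → Fin n → Set
JoinV u v = Rest u v ⊎ Fin 6

join : {n : ℕ} → Adj (Fin n) → (u v : Fin n) → Adj (JoinV u v)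
join adj u v (inj₁ a) (inj₁ b) = adj (proj₁ a) (proj₁ b)
join adj u v (inj₂ i) (inj₂ j) = P7⁻ i j
join adj u v (inj₁ a) (inj₂ i) = if inD₂ i then adj (proj₁ a) u else adj (proj₁ a) v
join adj u v (inj₂ i) (inj₁ a) = if inD₂ i then adj u (proj₁ a) else adj v (proj₁ a)

-- The pair (A₁, A₂) = (D₂, D₁) created by the join is nested iff some
-- X ⊇ A₁ ∪ A₂ = V(S) induces P₇, i.e. some embedding of P₇ covers V(S).
Nested : {n : ℕ} → Adj (Fin n) → (u v : Fin n) → Set
Nested adj u v =
  Σ (Fin 7 → JoinV u v) λ f →
    Injective _≡_ _≡_ f × (∀ i j → join adj u v (f i) (f j) ≡ P7 i j)
    × (∀ (s : Fin 6) → ∃ λ k → f k ≡ inj₂ s)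

-- Bridges.  An ordering σ = (v₁,…,vₙ) is given by the injective position
-- map p : Fin n → Fin n (vertex w = v_{p w}).

module _ {n : ℕ} (adj : Adj (Fin n)) (p : Fin n → Fin n) where

  Back : Fin n → Fin n → Set
  Back a b = (p b < p a) × adj a b ≡ true

  Cross : Fin n → Fin n → Fin n → Set
  Cross k a b = Back a b × (p b < k) × (k < p a)

  CrossMatching : Fin n → Set
  CrossMatching k = ∀ a b a' b' → Cross k a b → Cross k a' b' →
    (a ≡ a' → b ≡ b') × (b ≡ b' → a ≡ a')

  Isolated : Fin n → Fin n → Set
  Isolated u v = Back u v ×
    (∀ a b → Back a b → (a ≡ u ⊎ a ≡ v ⊎ b ≡ u ⊎ b ≡ v) → (a ≡ u × b ≡ v))

Bridge : {n : ℕ} → Adj (Fin n) → Fin n → Fin n → Set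
Bridge {n} adj u v =
  Σ (Fin n → Fin n) λ p → Injective _≡_ _≡_ p ×
    (p v < p u) × Isolated adj p u v ×
    CrossMatching adj p (p u) × CrossMatching adj p (p v)

-- In the join, a vertex w of T other than u and v sees D₂ as it sees u and D₁ as it
-- sees v.  If u → w → v, then w and the inserted P₇⁻ span a P₇, so the pair is nested;
-- conversely, the few ways a P₇ can contain P₇⁻ and one more vertex all need such a w.
-- Without it, every other vertex dominates u and v, lies between them (v → w → u) or is
-- dominated by both, and uv is isolated exactly in the orderings that place these three
-- classes as: dominating, v, between, u, dominated.  In such an ordering the matching
-- conditions of a bridge say that for x = u, v no two edges from N⁺(x) to N⁻(x), both
-- avoiding u and v, share an endpoint.  Two such edges, with an edge of P₇⁻ inside D₂ (for u) or inside D₁ (for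
-- v), form a Δ(1,2,2) in the join.  Conversely, an exhaustive check over the kinds of its
-- five vertices shows that a Δ(1,2,2) in the join without two such edges uses at most
-- one vertex of D₂ and one of D₁, joined like u and v, so it collapses onto a Δ(1,2,2)
-- in T.

module Submission where

open import Defs
open import Data.Nat using (ℕ)
open import Data.Fin using (Fin)
open import Data.Bool using (true)
open import Data.Product using (_×_)
open import Relation.Nullary using (¬_)
open import Relation.Binary.PropositionalEquality using (_≡_)
open import Function.Bundles using (_⇔_)

open import Data.Bool using (Bool; false; not; if_then_else_)
open import Data.Bool.Properties using (T-∧; T-irrelevant; if-float; T-≡) renaming (_≟_ to _≟ᵇ_)
open import Data.Empty using (⊥; ⊥-elim)
open import Data.Fin using (fromℕ<; combine; _<_; _≟_; _<?_) renaming (suc to fsuc)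
open import Data.Fin.Patterns using (0F; 1F; 2F; 3F; 4F)
open import Data.Fin.Properties
  using (all?; any?; pigeonhole; <-cmp; <-irrefl; <-asym; <-trans; <⇒≢; toℕ-fromℕ<;
         combine-injectiveʳ; combine-monoˡ-<)
open import Data.Fin.Subset using (Subset; _∈_; _⊂_; ∣_∣) renaming (⊤ to full)
open import Data.Fin.Subset.Properties using (p⊂q⇒∣p∣<∣q∣; ∣⊤∣≡n; ⊆⊤; ∈⊤)
open import Data.Maybe using (Maybe; just; nothing)
open import Data.Maybe.Relation.Unary.All as AllMaybe
  using (just; nothing) renaming (All to AllMaybe)
import Data.Nat as ℕ
open import Data.Nat.Properties using (n<1+n)
open import Data.Product using (Σ; ∃; ∃₂; _,_; proj₁; proj₂)
import Data.Product as Product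
open import Data.Sum as Sum using (_⊎_; inj₁; inj₂; [_,_]′; map₂)
open import Data.Unit using (tt) renaming (⊤ to Unit)
open import Data.Vec using (Vec; []; _∷_; lookup; tabulate)
open import Data.Vec.Properties using (lookup∘tabulate; lookup⇒[]=; []=⇒lookup)
open import Function.Base using (_∘_; id)
open import Function.Bundles using (mk⇔; Equivalence)
open import Function.Definitions using (Injective)
open import Relation.Binary.Definitions using (tri<; tri≈; tri>)
open import Relation.Binary.PropositionalEquality
  using (refl; sym; trans; cong; cong₂; subst; subst₂; _≢_; ≢-sym; module ≡-Reasoning)
open import Relation.Nullary using (Dec; yes; no; contradiction)
open import Relation.Nullary.Decidable
  using (⌊_⌋; map′; _×-dec_; _→-dec_; _⊎-dec_; ¬?; from-yes; fromWitness; toWitness;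
         fromWitnessFalse; toWitnessFalse; decidable-stable)

module _ {V : Set} {adj : Adj V} (tour : IsTournament adj) where

  reverse : ∀ {x y b} → x ≢ y → adj x y ≡ b → adj y x ≡ not b
  reverse x≢y refl = proj₂ tour _ _ (≢-sym x≢y)

  edge⇒≢ : ∀ {x y} → adj x y ≡ true → x ≢ y
  edge⇒≢ {x} xy refl = contradiction (trans (sym xy) (proj₁ tour x)) λ ()

  edge⇒non-edge : ∀ {x y} → adj x y ≡ true → adj y x ≡ false
  edge⇒non-edge xy = reverse (edge⇒≢ xy) xy

  orient : ∀ {x y} → x ≢ y → adj x y ≡ true ⊎ adj y x ≡ true
  orient {x} {y} x≢y with adj x y in xy
  ... | true  = inj₁ refl
  ... | false = inj₂ (reverse x≢y xy)

tournament? : ∀ {k} (S : Adj (Fin k)) → Dec (IsTournament S)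
tournament? S = (all? λ i → S i i ≟ᵇ false)
          ×-dec (all? λ i → all? λ j → ¬? (i ≟ j) →-dec (S i j ≟ᵇ not (S j i)))

Δ122-isTournament : IsTournament Δ122
Δ122-isTournament = from-yes (tournament? Δ122)

P7⁻-isTournament : IsTournament P7⁻
P7⁻-isTournament = from-yes (tournament? P7⁻)

module _ {V : Set} {adj : Adj V} (tour : IsTournament adj) where

  embedding-from-edges : ∀ {k} {S : Adj (Fin k)} → IsTournament S → (f : Fin k → V) →
    (∀ i j → S i j ≡ true → adj (f i) (f j) ≡ true) → Contains adj S
  embedding-from-edges {S = S} S-tour f f-edge = f , f-injective , f-adj
    where
    linked : ∀ {i j} → i ≢ j → adj (f i) (f j) ≡ true ⊎ adj (f j) (f i) ≡ true
    linked {i} {j} i≢j = Sum.map (f-edge i j) (f-edge j i) (orient S-tour i≢j)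

    f-injective : Injective _≡_ _≡_ f
    f-injective {i} {j} fi≡fj = decidable-stable (i ≟ j) λ i≢j →
      [ (λ ij → edge⇒≢ tour ij fi≡fj) , (λ ji → edge⇒≢ tour ji (sym fi≡fj)) ]′ (linked i≢j)

    f-adj : ∀ i j → adj (f i) (f j) ≡ S i j
    f-adj i j with i ≟ j
    ... | yes refl = trans (proj₁ tour (f i)) (sym (proj₁ S-tour i))
    ... | no i≢j with S i j in ij
    ...   | true  = f-edge i j ij
    ...   | false = reverse tour (≢-sym (i≢j ∘ f-injective)) (f-edge j i (reverse S-tour i≢j ij))

  Δ122-by-edges : ∀ {x y₁ y₂ z₁ z₂} →
    adj x y₁ ≡ true → adj x y₂ ≡ true → adj y₁ y₂ ≡ true →
    adj y₁ z₁ ≡ true → adj y₁ z₂ ≡ true → adj y₂ z₁ ≡ true → adj y₂ z₂ ≡ true →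
    adj z₁ z₂ ≡ true → adj z₁ x ≡ true → adj z₂ x ≡ true → Contains adj Δ122
  Δ122-by-edges {x} {y₁} {y₂} {z₁} {z₂} xy₁ xy₂ y₁y₂ y₁z₁ y₁z₂ y₂z₁ y₂z₂ z₁z₂ z₁x z₂x =
    embedding-from-edges Δ122-isTournament f edges
    where
    f : Fin 5 → V
    f = lookup (x ∷ y₁ ∷ y₂ ∷ z₁ ∷ z₂ ∷ [])

    edges : ∀ i j → Δ122 i j ≡ true → adj (f i) (f j) ≡ true
    edges 0F = λ { 1F _ → xy₁ ; 2F _ → xy₂ ; 0F () ; 3F () ; 4F () }
    edges 1F = λ { 2F _ → y₁y₂ ; 3F _ → y₁z₁ ; 4F _ → y₁z₂ ; 0F () ; 1F () }
    edges 2F = λ { 3F _ → y₂z₁ ; 4F _ → y₂z₂ ; 0F () ; 1F () ; 2F () }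
    edges 3F = λ { 0F _ → z₁x ; 4F _ → z₁z₂ ; 1F () ; 2F () ; 3F () }
    edges 4F = λ { 0F _ → z₂x ; 1F () ; 2F () ; 3F () ; 4F () }

  Δ122-from : ∀ {x y₁ y₂ z₁ z₂} → y₁ ≢ y₂ → z₁ ≢ z₂ →
    adj x y₁ ≡ true → adj x y₂ ≡ true →
    adj y₁ z₁ ≡ true → adj y₁ z₂ ≡ true → adj y₂ z₁ ≡ true → adj y₂ z₂ ≡ true →
    adj z₁ x ≡ true → adj z₂ x ≡ true → Contains adj Δ122
  Δ122-from y₁≢y₂ z₁≢z₂ xy₁ xy₂ y₁z₁ y₁z₂ y₂z₁ y₂z₂ z₁x z₂x
    with orient tour y₁≢y₂ | orient tour z₁≢z₂
  ... | inj₁ y₁y₂ | inj₁ z₁z₂ = Δ122-by-edges xy₁ xy₂ y₁y₂ y₁z₁ y₁z₂ y₂z₁ y₂z₂ z₁z₂ z₁x z₂x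
  ... | inj₁ y₁y₂ | inj₂ z₂z₁ = Δ122-by-edges xy₁ xy₂ y₁y₂ y₁z₂ y₁z₁ y₂z₂ y₂z₁ z₂z₁ z₂x z₁x
  ... | inj₂ y₂y₁ | inj₁ z₁z₂ = Δ122-by-edges xy₂ xy₁ y₂y₁ y₂z₁ y₂z₂ y₁z₁ y₁z₂ z₁z₂ z₁x z₂x
  ... | inj₂ y₂y₁ | inj₂ z₂z₁ = Δ122-by-edges xy₂ xy₁ y₂y₁ y₂z₂ y₂z₁ y₁z₂ y₁z₁ z₂z₁ z₂x z₁x

P7-0-out : ∀ s → P7 0F (fsuc s) ≡ (if inD₂ s then false else true)
P7-0-out = from-yes (all? λ s → P7 0F (fsuc s) ≟ᵇ (if inD₂ s then false else true))

P7-0-in : ∀ s → P7 (fsuc s) 0F ≡ (if inD₂ s then true else false)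
P7-0-in = from-yes (all? λ s → P7 (fsuc s) 0F ≟ᵇ (if inD₂ s then true else false))

IsMatching : {V : Set} → (V → V → Set) → Set
IsMatching E = ∀ a b a' b' → E a b → E a' b' → (a ≡ a' → b ≡ b') × (b ≡ b' → a ≡ a')

IsMatching-antimono : {V : Set} {E F : V → V → Set} →
  (∀ {a b} → E a b → F a b) → IsMatching F → IsMatching E
IsMatching-antimono E⊆F match a b a' b' ab a'b' = match a b a' b' (E⊆F ab) (E⊆F a'b')

isMatching? : ∀ {m} {E : Fin m → Fin m → Set} → (∀ a b → Dec (E a b)) → Dec (IsMatching E)
isMatching? E? = all? λ a → all? λ b → all? λ a' → all? λ b' →
  E? a b →-dec E? a' b' →-dec ((a ≟ a') →-dec (b ≟ b')) ×-dec ((b ≟ b') →-dec (a ≟ a'))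

module Ranking {n m : ℕ} (key : Fin n → Fin m) (key-injective : Injective _≡_ _≡_ key) where

  below : Fin n → Subset n
  below w = tabulate λ w' → ⌊ key w' <? key w ⌋

  ∈-below⁺ : ∀ {w' w} → key w' < key w → w' ∈ below w
  ∈-below⁺ {w'} {w} lt = lookup⇒[]= w' (below w)
    (trans (lookup∘tabulate _ w') (Equivalence.to T-≡ (fromWitness lt)))

  ∈-below⁻ : ∀ {w' w} → w' ∈ below w → key w' < key w
  ∈-below⁻ {w'} {w} w'∈ = toWitness
    (Equivalence.from T-≡ (trans (sym (lookup∘tabulate _ w')) ([]=⇒lookup w'∈)))

  below-⊂ : ∀ {a b} → key a < key b → below a ⊂ below b
  below-⊂ {a} lt = (λ x∈ → ∈-below⁺ (<-trans (∈-below⁻ x∈) lt)) ,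
                   a , ∈-below⁺ lt , λ a∈ → <-irrefl refl (∈-below⁻ a∈)

  below-⊂-full : ∀ w → below w ⊂ full
  below-⊂-full w = ⊆⊤ , w , ∈⊤ , λ w∈ → <-irrefl refl (∈-below⁻ w∈)

  position : Fin n → Fin n
  position w = fromℕ< (subst (∣ below w ∣ ℕ.<_) (∣⊤∣≡n n) (p⊂q⇒∣p∣<∣q∣ (below-⊂-full w)))

  position-mono : ∀ {a b} → key a < key b → position a < position b
  position-mono lt =
    subst₂ ℕ._<_ (sym (toℕ-fromℕ< _)) (sym (toℕ-fromℕ< _)) (p⊂q⇒∣p∣<∣q∣ (below-⊂ lt))

  position-injective : Injective _≡_ _≡_ position
  position-injective {a} {b} eq with <-cmp (key a) (key b)
  ... | tri< lt _ _ = contradiction eq (<⇒≢ (position-mono lt))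
  ... | tri≈ _ eq′ _ = key-injective eq′
  ... | tri> _ _ gt = contradiction (sym eq) (<⇒≢ (position-mono gt))

inj₁? : ∀ {A B : Set} (x : A ⊎ B) → Dec (∃ λ a → x ≡ inj₁ a)
inj₁? (inj₁ a) = yes (a , refl)
inj₁? (inj₂ _) = no λ { (_ , ()) }

inj₁-in-image : ∀ {A : Set} {m} (f : Fin (ℕ.suc m) → A ⊎ Fin m) → Injective _≡_ _≡_ f →
  ∃₂ λ k a → f k ≡ inj₁ a
inj₁-in-image {m = m} f f-injective = decidable-stable (any? (inj₁? ∘ f)) λ none →
  let i , j , i<j , same = pigeonhole (n<1+n m) (proj₁ ∘ index none) in
  <⇒≢ i<j (f-injective (trans (proj₂ (index none i))
                              (trans (cong inj₂ same) (sym (proj₂ (index none j))))))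
  where
  index : ¬ (∃₂ λ k a → f k ≡ inj₁ a) → ∀ k → Σ (Fin m) λ s → f k ≡ inj₂ s
  index none k with f k in fk
  ... | inj₁ a = ⊥-elim (none (k , a , fk))
  ... | inj₂ s = s , refl

-- Kinds of vertices of the join

data End : Set where
  uEnd vEnd : End

-- A vertex w ∉ {u, v} has profile k when it beats the end e of uv exactly if beats e k:
-- it dominates both ends, lies between them (v → w → u), or is dominated by both.  The
-- fourth case, u → w → v, is what makes the pair nested.  An ordering witnessing a
-- bridge puts w before the end e exactly when w beats it.
data Profile : Set where
  dominating between dominated : Profile

beats : End → Profile → Bool
beats _    dominating = true
beats uEnd between    = true
beats vEnd between    = false
beats _    dominated  = false

shadow : Fin 6 → End
shadow s = if inD₂ s then uEnd else vEnd

data Kind : Set where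
  core : Fin 6 → Kind
  rest : Profile → Kind

-- nothing: the kinds of two vertices of T do not determine the edge between them.
kadj : Kind → Kind → Maybe Bool
kadj (core s) (core t) = just (P7⁻ s t)
kadj (rest k) (core s) = just (beats (shadow s) k)
kadj (core s) (rest k) = just (not (beats (shadow s) k))
kadj (rest _) (rest _) = nothing

Realises : ∀ {m} → Vec Kind m → Adj (Fin m) → Set
Realises κ H = ∀ i j → AllMaybe (_≡ H i j) (kadj (lookup κ i) (lookup κ j))

IsRest : Kind → Set
IsRest (core _) = ⊥
IsRest (rest _) = Unit

Crosses : End → Kind → Kind → Set
Crosses e (rest k) (rest l) = beats e k ≡ false × beats e l ≡ true
Crosses _ _        _        = ⊥

crosses⇒rest : ∀ {e k l} → Crosses e k l → IsRest k × IsRest l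
crosses⇒rest {k = rest _} {rest _} _ = tt , tt

CrossingEdge : ∀ {m} → End → Vec Kind m → Adj (Fin m) → Fin m → Fin m → Set
CrossingEdge e κ H i j = H i j ≡ true × Crosses e (lookup κ i) (lookup κ j)

Projects : Kind → Kind → Set
Projects (core s) (core t) = shadow s ≡ uEnd × shadow t ≡ vEnd
Projects _        _        = Unit

ProjectsEdges : ∀ {m} → Vec Kind m → Adj (Fin m) → Set
ProjectsEdges κ H = ∀ i j → H i j ≡ true → Projects (lookup κ i) (lookup κ j)

pole-slot : End → Fin 5
pole-slot uEnd = 3F
pole-slot vEnd = 1F

profile-slot : Profile → Fin 5
profile-slot dominating = 0F
profile-slot between    = 2F
profile-slot dominated  = 4F

_≟ᴱ_ : (e f : End) → Dec (e ≡ f)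
uEnd ≟ᴱ uEnd = yes refl
uEnd ≟ᴱ vEnd = no λ ()
vEnd ≟ᴱ uEnd = no λ ()
vEnd ≟ᴱ vEnd = yes refl

∀-End? : {P : End → Set} → (∀ e → Dec (P e)) → Dec (∀ e → P e)
∀-End? P? = map′ (λ { (pu , pv) uEnd → pu ; (pu , pv) vEnd → pv })
                 (λ h → h uEnd , h vEnd) (P? uEnd ×-dec P? vEnd)

∀-Profile? : {P : Profile → Set} → (∀ k → Dec (P k)) → Dec (∀ k → P k)
∀-Profile? P? =
  map′ (λ { (a , b , c) dominating → a ; (a , b , c) between → b ; (a , b , c) dominated → c })
       (λ h → h dominating , h between , h dominated)
       (P? dominating ×-dec P? between ×-dec P? dominated)

∀-Kind? : {P : Kind → Set} → (∀ k → Dec (P k)) → Dec (∀ k → P k)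
∀-Kind? P? = map′ (λ { (c , r) (core s) → c s ; (c , r) (rest k) → r k })
                  (λ h → (λ s → h (core s)) , (λ k → h (rest k)))
                  ((all? λ s → P? (core s)) ×-dec ∀-Profile? (λ k → P? (rest k)))

∀-Vec? : ∀ {k} m {P : Vec (Fin k) m → Set} → (∀ ps → Dec (P ps)) → Dec (∀ ps → P ps)
∀-Vec? ℕ.zero    P? = map′ (λ { p [] → p }) (λ h → h []) (P? [])
∀-Vec? (ℕ.suc m) P? = map′ (λ { h (i ∷ ps) → h i ps }) (λ h i ps → h (i ∷ ps))
                           (all? λ i → ∀-Vec? m λ ps → P? (i ∷ ps))

realises? : ∀ {m} (κ : Vec Kind m) (H : Adj (Fin m)) → Dec (Realises κ H)
realises? κ H = all? λ i → all? λ j → AllMaybe.dec (_≟ᵇ H i j) (kadj (lookup κ i) (lookup κ j))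

-- A kind is prepended only to realisations of the pattern on the remaining vertices.
∀-realisation? : ∀ {m} (H : Adj (Fin m)) {Q : Vec Kind m → Set} → (∀ κ → Dec (Q κ)) →
  Dec (∀ κ → Realises κ H → Q κ)
∀-realisation? {ℕ.zero} H Q? = map′ (λ { q [] _ → q }) (λ h → h [] λ ()) (Q? [])
∀-realisation? {ℕ.suc m} H Q? =
  map′ (λ { h (k ∷ κ) r → h κ (λ i j → r (fsuc i) (fsuc j)) k r }) (λ h κ _ k r → h (k ∷ κ) r)
       (∀-realisation? (λ i j → H (fsuc i) (fsuc j)) λ κ →
          ∀-Kind? λ k → realises? (k ∷ κ) H →-dec Q? (k ∷ κ))

crosses? : ∀ e k l → Dec (Crosses e k l)
crosses? e (rest k) (rest l) = (beats e k ≟ᵇ false) ×-dec (beats e l ≟ᵇ true)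
crosses? e (core _) _        = no λ ()
crosses? e (rest _) (core _) = no λ ()

projects? : ∀ k l → Dec (Projects k l)
projects? (core s) (core t) = (shadow s ≟ᴱ uEnd) ×-dec (shadow t ≟ᴱ vEnd)
projects? (core _) (rest _) = yes tt
projects? (rest _) (core _) = yes tt
projects? (rest _) (rest _) = yes tt

Δ122-realisations-project : ∀ κ → Realises κ Δ122 →
  (∀ e → IsMatching (CrossingEdge e κ Δ122)) → ProjectsEdges κ Δ122
Δ122-realisations-project κ realised matching =
  [ id , (λ not-matching → contradiction matching not-matching) ]′ (check κ realised)
  where
  -- Deciding the conclusion before the matching hypothesis keeps the search fast.
  check : ∀ κ → Realises κ Δ122 →
    ProjectsEdges κ Δ122 ⊎ ¬ (∀ e → IsMatching (CrossingEdge e κ Δ122))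
  check = from-yes (∀-realisation? Δ122 λ κ →
    (all? λ i → all? λ j → (Δ122 i j ≟ᵇ true) →-dec projects? (lookup κ i) (lookup κ j))
    ⊎-dec ¬? (∀-End? λ e → isMatching? λ i j →
                 (Δ122 i j ≟ᵇ true) ×-dec crosses? e (lookup κ i) (lookup κ j)))

no-rest-profile-in-P7 : ∀ k (ps : Vec (Fin 7) 4) →
  ¬ Realises (rest k ∷ core 0F ∷ core 1F ∷ core 2F ∷ []) (λ i j → P7 (lookup ps i) (lookup ps j))
no-rest-profile-in-P7 = from-yes (∀-Profile? λ k → ∀-Vec? 4 λ ps →
  ¬? (realises? (rest k ∷ core 0F ∷ core 1F ∷ core 2F ∷ [])
                (λ i j → P7 (lookup ps i) (lookup ps j))))

slot-before : ∀ e k → beats e k ≡ true → profile-slot k < pole-slot e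
slot-before = from-yes (∀-End? λ e → ∀-Profile? λ k →
  (beats e k ≟ᵇ true) →-dec (profile-slot k <? pole-slot e))

slot-after : ∀ e k → beats e k ≡ false → pole-slot e < profile-slot k
slot-after = from-yes (∀-End? λ e → ∀-Profile? λ k →
  (beats e k ≟ᵇ false) →-dec (pole-slot e <? profile-slot k))

module Join {n : ℕ} (adj : Adj (Fin n)) (tour : IsTournament adj) {u v : Fin n}
            (uv : adj u v ≡ true) where

  pole : End → Fin n
  pole uEnd = u
  pole vEnd = v

  pole-injective : ∀ {e f} → pole e ≡ pole f → e ≡ f
  pole-injective {uEnd} {uEnd} _   = refl
  pole-injective {uEnd} {vEnd} u≡v = contradiction u≡v (edge⇒≢ tour uv)
  pole-injective {vEnd} {uEnd} v≡u = contradiction (sym v≡u) (edge⇒≢ tour uv)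
  pole-injective {vEnd} {vEnd} _   = refl

  poles-edge : ∀ e f → adj (pole e) (pole f) ≡ true → e ≡ uEnd × f ≡ vEnd
  poles-edge uEnd uEnd uu = contradiction refl (edge⇒≢ tour uu)
  poles-edge uEnd vEnd _  = refl , refl
  poles-edge vEnd uEnd vu = contradiction (trans (sym vu) (edge⇒non-edge tour uv)) λ ()
  poles-edge vEnd vEnd vv = contradiction refl (edge⇒≢ tour vv)

  Outside : Fin n → Set
  Outside w = ∀ e → w ≢ pole e

  outside : ∀ {w} → w ≢ u → w ≢ v → Outside w
  outside w≢u w≢v uEnd = w≢u
  outside w≢u w≢v vEnd = w≢v

  pole? : ∀ w → (∃ λ e → w ≡ pole e) ⊎ Outside w
  pole? w with w ≟ u | w ≟ v
  ... | yes w≡u | _       = inj₁ (uEnd , w≡u)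
  ... | no _    | yes w≡v = inj₁ (vEnd , w≡v)
  ... | no w≢u  | no w≢v  = inj₂ (outside w≢u w≢v)

  NoMiddle : Set
  NoMiddle = ∀ w → adj u w ≡ true → adj w v ≡ true → ⊥

  middle-outside : ∀ {w} → adj u w ≡ true → adj w v ≡ true → Outside w
  middle-outside uw wv = outside (≢-sym (edge⇒≢ tour uw)) (edge⇒≢ tour wv)

  HasProfile : Fin n → Profile → Set
  HasProfile w k = ∀ e → adj w (pole e) ≡ beats e k

  profile-of : NoMiddle → ∀ w → Outside w → ∃ (HasProfile w)
  profile-of nm w out with adj w u in wu | adj w v in wv
  ... | true  | true  = dominating , λ { uEnd → wu ; vEnd → wv }
  ... | true  | false = between    , λ { uEnd → wu ; vEnd → wv }
  ... | false | false = dominated  , λ { uEnd → wu ; vEnd → wv }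
  ... | false | true  = ⊥-elim (nm w (reverse tour (out uEnd) wu) wv)

  CutEdge : End → Fin n → Fin n → Set
  CutEdge e a b =
    Outside a × Outside b × adj (pole e) a ≡ true × adj b (pole e) ≡ true × adj a b ≡ true

  MatchingAt : End → Set
  MatchingAt e = IsMatching (CutEdge e)

  toRest : ∀ w → Outside w → Rest u v
  toRest w out = w , Equivalence.from T-∧ (fromWitnessFalse {a? = w ≟ u} (out uEnd) ,
                                       fromWitnessFalse {a? = w ≟ v} (out vEnd))

  rest-outside : (r : Rest u v) → Outside (proj₁ r)
  rest-outside (w , t) uEnd = toWitnessFalse {a? = w ≟ u} (proj₁ (Equivalence.to T-∧ t))
  rest-outside (w , t) vEnd = toWitnessFalse {a? = w ≟ v} (proj₂ (Equivalence.to T-∧ t))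

  Rest-≡ : ∀ {r r' : Rest u v} → proj₁ r ≡ proj₁ r' → r ≡ r'
  Rest-≡ {w , t} {.w , t'} refl = cong (w ,_) (T-irrelevant t t')

  J : Adj (JoinV u v)
  J = join adj u v

  join-rest-core : ∀ r s → J (inj₁ r) (inj₂ s) ≡ adj (proj₁ r) (pole (shadow s))
  join-rest-core r s = sym (if-float (λ e → adj (proj₁ r) (pole e)) (inD₂ s))

  join-core-rest : ∀ s r → J (inj₂ s) (inj₁ r) ≡ adj (pole (shadow s)) (proj₁ r)
  join-core-rest s r = sym (if-float (λ e → adj (pole e) (proj₁ r)) (inD₂ s))

  J-isTournament : IsTournament J
  J-isTournament = irreflexive , antisymmetric
    where
    irreflexive : ∀ x → J x x ≡ false
    irreflexive (inj₁ r) = proj₁ tour (proj₁ r)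
    irreflexive (inj₂ s) = proj₁ P7⁻-isTournament s

    antisymmetric : ∀ x y → x ≢ y → J x y ≡ not (J y x)
    antisymmetric (inj₁ r) (inj₁ r') r≢r' = proj₂ tour _ _ (r≢r' ∘ cong inj₁ ∘ Rest-≡)
    antisymmetric (inj₂ s) (inj₂ t) s≢t = proj₂ P7⁻-isTournament s t (s≢t ∘ cong inj₂)
    antisymmetric (inj₁ r) (inj₂ s) _ = begin
      J (inj₁ r) (inj₂ s)                   ≡⟨ join-rest-core r s ⟩
      adj (proj₁ r) (pole (shadow s))       ≡⟨ proj₂ tour _ _ (rest-outside r (shadow s)) ⟩
      not (adj (pole (shadow s)) (proj₁ r)) ≡⟨ cong not (join-core-rest s r) ⟨
      not (J (inj₂ s) (inj₁ r))             ∎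
      where open ≡-Reasoning
    antisymmetric (inj₂ s) (inj₁ r) _ = begin
      J (inj₂ s) (inj₁ r)                   ≡⟨ join-core-rest s r ⟩
      adj (pole (shadow s)) (proj₁ r)       ≡⟨ proj₂ tour _ _ (≢-sym (rest-outside r (shadow s))) ⟩
      not (adj (proj₁ r) (pole (shadow s))) ≡⟨ cong not (join-rest-core r s) ⟨
      not (J (inj₁ r) (inj₂ s))             ∎
      where open ≡-Reasoning

  contract : JoinV u v → Fin n
  contract (inj₁ r) = proj₁ r
  contract (inj₂ s) = pole (shadow s)

  data HasKind : JoinV u v → Kind → Set where
    core : ∀ s → HasKind (inj₂ s) (core s)
    rest : ∀ {r k} → HasProfile (proj₁ r) k → HasKind (inj₁ r) (rest k)

  kind-of : NoMiddle → ∀ x → ∃ (HasKind x)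
  kind-of nm (inj₁ r) = let k , has = profile-of nm (proj₁ r) (rest-outside r) in rest k , rest has
  kind-of _  (inj₂ s) = core s , core s

  rest→core : ∀ r s {k} → HasProfile (proj₁ r) k → J (inj₁ r) (inj₂ s) ≡ beats (shadow s) k
  rest→core r s has = trans (join-rest-core r s) (has (shadow s))

  kadj-sound : ∀ {x y k l} → HasKind x k → HasKind y l → AllMaybe (J x y ≡_) (kadj k l)
  kadj-sound (core s)       (core t)       = just refl
  kadj-sound (rest {r} has) (core s)       = just (rest→core r s has)
  kadj-sound (core s)       (rest {r} has) =
    just (reverse J-isTournament {inj₁ r} {inj₂ s} (λ ()) (rest→core r s has))
  kadj-sound (rest _)       (rest _)       = nothing

  realises : ∀ {m} {H : Adj (Fin m)} {κ : Vec Kind m} (g : Fin m → JoinV u v) →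
    (∀ i j → J (g i) (g j) ≡ H i j) → (∀ i → HasKind (g i) (lookup κ i)) → Realises κ H
  realises g g-adj typed i j =
    AllMaybe.map (λ eq → trans (sym eq) (g-adj i j)) (kadj-sound (typed i) (typed j))

  contract-edge : ∀ {x y k l} → HasKind x k → HasKind y l → Projects k l →
    J x y ≡ true → adj (contract x) (contract y) ≡ true
  contract-edge (rest _)       (rest _)       _ xy = xy
  contract-edge (rest {r} _)   (core s)       _ xy = trans (sym (join-rest-core r s)) xy
  contract-edge (core s)       (rest {r} _)   _ xy = trans (sym (join-core-rest s r)) xy
  contract-edge (core s)       (core t)       (s↦u , t↦v) _ rewrite s↦u | t↦v = uv

  contract-injective : ∀ {x y k l} → HasKind x k → HasKind y l → IsRest k → IsRest l →
    contract x ≡ contract y → x ≡ y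
  contract-injective (rest _) (rest _) _ _ eq = cong inj₁ (Rest-≡ eq)

  crossing⇒cut : ∀ {e x y k l} → HasKind x k → HasKind y l → Crosses e k l →
    J x y ≡ true → CutEdge e (contract x) (contract y)
  crossing⇒cut {e} (rest {r} hx) (rest {r'} hy) (k-after , l-before) xy =
    rest-outside r , rest-outside r' ,
    reverse tour (rest-outside r e) (trans (hx e) k-after) , trans (hy e) l-before , xy

  -- Nested pairs

  middle⇒nested : ∀ {w} → adj u w ≡ true → adj w v ≡ true → Nested adj u v
  middle⇒nested {w} uw wv = f , f-injective , f-adj , λ s → fsuc s , refl
    where
    r : Rest u v
    r = toRest w (middle-outside uw wv)

    f : Fin 7 → JoinV u v
    f 0F       = inj₁ r
    f (fsuc s) = inj₂ s

    f-injective : Injective _≡_ _≡_ f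
    f-injective {0F}     {0F}     _    = refl
    f-injective {fsuc _} {fsuc _} refl = refl

    f-adj : ∀ i j → J (f i) (f j) ≡ P7 i j
    f-adj 0F       0F       = proj₁ tour w
    f-adj 0F       (fsuc s) =
      trans (cong₂ (λ x y → if inD₂ s then x else y) (edge⇒non-edge tour uw) wv) (sym (P7-0-out s))
    f-adj (fsuc s) 0F       =
      trans (cong₂ (λ x y → if inD₂ s then x else y) uw (edge⇒non-edge tour wv)) (sym (P7-0-in s))
    f-adj (fsuc s) (fsuc t) = refl

  no-middle⇒not-nested : NoMiddle → ¬ Nested adj u v
  no-middle⇒not-nested nm (f , f-injective , f-adj , covers) with inj₁-in-image f f-injective
  ... | i₀ , r , fi₀≡r with profile-of nm (proj₁ r) (rest-outside r)
  ...   | k , has =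
    no-rest-profile-in-P7 k ps (realises {κ = κ} (f ∘ lookup ps) (λ _ _ → f-adj _ _) typed)
    where
    ps : Vec (Fin 7) 4
    ps = i₀ ∷ proj₁ (covers 0F) ∷ proj₁ (covers 1F) ∷ proj₁ (covers 2F) ∷ []

    κ : Vec Kind 4
    κ = rest k ∷ core 0F ∷ core 1F ∷ core 2F ∷ []

    typed : ∀ i → HasKind (f (lookup ps i)) (lookup κ i)
    typed 0F = subst (λ x → HasKind x (rest k)) (sym fi₀≡r) (rest has)
    typed 1F = subst (λ x → HasKind x (core 0F)) (sym (proj₂ (covers 0F))) (core 0F)
    typed 2F = subst (λ x → HasKind x (core 1F)) (sym (proj₂ (covers 1F))) (core 1F)
    typed 3F = subst (λ x → HasKind x (core 2F)) (sym (proj₂ (covers 2F))) (core 2F)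

  not-nested⇔no-middle : (¬ Nested adj u v) ⇔ NoMiddle
  not-nested⇔no-middle =
    mk⇔ (λ not-nested w uw wv → not-nested (middle⇒nested uw wv)) no-middle⇒not-nested

  -- Copies of Δ(1,2,2) in the join

  twins : ∀ e → ∃₂ λ s t → shadow s ≡ e × shadow t ≡ e × P7⁻ s t ≡ true
  twins uEnd = 2F , 4F , refl , refl , refl
  twins vEnd = 0F , 1F , refl , refl , refl

  into-core : ∀ r s {e} → shadow s ≡ e → adj (proj₁ r) (pole e) ≡ true → J (inj₁ r) (inj₂ s) ≡ true
  into-core r s refl w→e = trans (join-rest-core r s) w→e

  from-core : ∀ s r {e} → shadow s ≡ e → adj (pole e) (proj₁ r) ≡ true → J (inj₂ s) (inj₁ r) ≡ true
  from-core s r refl e→w = trans (join-core-rest s r) e→w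

  cut-edges-with-common-tail : ∀ {e a b b'} → CutEdge e a b → CutEdge e a b' → b ≢ b' →
    Contains J Δ122
  cut-edges-with-common-tail {e} (out-a , out-b , e→a , b→e , ab) (_ , out-b' , _ , b'→e , ab') b≢b'
    with twins e
  ... | s , t , s↦e , t↦e , st =
    Δ122-from J-isTournament {inj₁ ra} {inj₁ rb} {inj₁ rb'} {inj₂ s} {inj₂ t}
      (b≢b' ∘ cong contract) (edge⇒≢ J-isTournament {inj₂ s} {inj₂ t} st) ab ab'
      (into-core rb s s↦e b→e) (into-core rb t t↦e b→e)
      (into-core rb' s s↦e b'→e) (into-core rb' t t↦e b'→e)
      (from-core s ra s↦e e→a) (from-core t ra t↦e e→a)
    where
    ra rb rb' : Rest u v
    ra  = toRest _ out-a
    rb  = toRest _ out-b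
    rb' = toRest _ out-b'

  cut-edges-with-common-head : ∀ {e a a' b} → CutEdge e a b → CutEdge e a' b → a ≢ a' →
    Contains J Δ122
  cut-edges-with-common-head {e} (out-a , out-b , e→a , b→e , ab) (out-a' , _ , e→a' , _ , a'b) a≢a'
    with twins e
  ... | s , t , s↦e , t↦e , st =
    Δ122-from J-isTournament {inj₁ rb} {inj₂ s} {inj₂ t} {inj₁ ra} {inj₁ ra'}
      (edge⇒≢ J-isTournament {inj₂ s} {inj₂ t} st) (a≢a' ∘ cong contract)
      (into-core rb s s↦e b→e) (into-core rb t t↦e b→e)
      (from-core s ra s↦e e→a) (from-core s ra' s↦e e→a')
      (from-core t ra t↦e e→a) (from-core t ra' t↦e e→a')
      ab a'b
    where
    ra ra' rb : Rest u v
    ra  = toRest _ out-a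
    ra' = toRest _ out-a'
    rb  = toRest _ out-b

  Δ122-free⇒matching : Free J Δ122 → ∀ e → MatchingAt e
  Δ122-free⇒matching free e a b a' b' ab a'b' = common-tail , common-head
    where
    common-tail : a ≡ a' → b ≡ b'
    common-tail refl = decidable-stable (b ≟ b') (free ∘ cut-edges-with-common-tail ab a'b')
    common-head : b ≡ b' → a ≡ a'
    common-head refl = decidable-stable (a ≟ a') (free ∘ cut-edges-with-common-head ab a'b')

  crossing-edges-match : ∀ {m e} {H : Adj (Fin m)} {κ : Vec Kind m} (g : Fin m → JoinV u v) →
    Injective _≡_ _≡_ g → (∀ i j → J (g i) (g j) ≡ H i j) → (∀ i → HasKind (g i) (lookup κ i)) →
    MatchingAt e → IsMatching (CrossingEdge e κ H)
  crossing-edges-match g g-injective g-adj typed match i j i' j' (ij , c) (i'j' , c')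
    with match _ _ _ _ (crossing⇒cut (typed i) (typed j) c (trans (g-adj i j) ij))
                       (crossing⇒cut (typed i') (typed j') c' (trans (g-adj i' j') i'j'))
  ... | same-tail , same-head =
    (λ i≡i' → g-injective (contract-injective (typed j) (typed j')
                (proj₂ (crosses⇒rest c)) (proj₂ (crosses⇒rest c'))
                (same-tail (cong (contract ∘ g) i≡i')))) ,
    (λ j≡j' → g-injective (contract-injective (typed i) (typed i')
                (proj₁ (crosses⇒rest c)) (proj₁ (crosses⇒rest c'))
                (same-head (cong (contract ∘ g) j≡j'))))

  matching⇒Δ122-free : Free adj Δ122 → NoMiddle → (∀ e → MatchingAt e) → Free J Δ122
  matching⇒Δ122-free T-free nm match (f , f-injective , f-adj) =
    T-free (embedding-from-edges tour Δ122-isTournament (contract ∘ f) contract-edges)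
    where
    κ : Vec Kind 5
    κ = tabulate (proj₁ ∘ kind-of nm ∘ f)

    typed : ∀ i → HasKind (f i) (lookup κ i)
    typed i = subst (HasKind (f i)) (sym (lookup∘tabulate (proj₁ ∘ kind-of nm ∘ f) i))
                    (proj₂ (kind-of nm (f i)))

    edge : ∀ {i j} → Δ122 i j ≡ true → J (f i) (f j) ≡ true
    edge {i} {j} ij = trans (f-adj i j) ij

    contract-edges : ∀ i j → Δ122 i j ≡ true → adj (contract (f i)) (contract (f j)) ≡ true
    contract-edges i j ij = contract-edge (typed i) (typed j)
      (Δ122-realisations-project κ (realises {κ = κ} f f-adj typed)
         (λ e → crossing-edges-match {κ = κ} f f-injective f-adj typed (match e)) i j ij)
      (edge ij)

  -- Bridges

  pole-is-end : ∀ e → pole e ≡ u ⊎ pole e ≡ v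
  pole-is-end uEnd = inj₁ refl
  pole-is-end vEnd = inj₂ refl

  RespectsPoles : (Fin n → Fin n) → Set
  RespectsPoles p = ∀ e w → Outside w →
    (adj w (pole e) ≡ true → p w < p (pole e)) × (adj (pole e) w ≡ true → p (pole e) < p w)

  isolated⇒respects : ∀ {p} → Injective _≡_ _≡_ p → Isolated adj p u v → RespectsPoles p
  isolated⇒respects {p} p-injective (_ , only) e w out = before , after
    where
    before : adj w (pole e) ≡ true → p w < p (pole e)
    before w→e with <-cmp (p w) (p (pole e))
    ... | tri< lt _ _ = lt
    ... | tri≈ _ eq _ = contradiction (p-injective eq) (out e)
    ... | tri> _ _ gt =
      contradiction (proj₁ (only w (pole e) (gt , w→e) (inj₂ (inj₂ (pole-is-end e))))) (out uEnd)

    after : adj (pole e) w ≡ true → p (pole e) < p w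
    after e→w with <-cmp (p (pole e)) (p w)
    ... | tri< lt _ _ = lt
    ... | tri≈ _ eq _ = contradiction (sym (p-injective eq)) (out e)
    ... | tri> _ _ gt =
      contradiction (proj₂ (only (pole e) w (gt , e→w) (map₂ inj₁ (pole-is-end e)))) (out vEnd)

  respects⇒no-middle : ∀ {p} → RespectsPoles p → p v < p u → NoMiddle
  respects⇒no-middle resp v<u w uw wv =
    <-asym v<u (<-trans (proj₂ (resp uEnd w out) uw) (proj₁ (resp vEnd w out) wv))
    where
    out : Outside w
    out = middle-outside uw wv

  respects⇒isolated : ∀ {p} → RespectsPoles p → p v < p u → Isolated adj p u v
  respects⇒isolated {p} resp v<u = (v<u , uv) , only
    where
    only : ∀ a b → Back adj p a b → (a ≡ u ⊎ a ≡ v ⊎ b ≡ u ⊎ b ≡ v) → a ≡ u × b ≡ v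
    only a b (b<a , ab) touches with pole? a | pole? b
    ... | inj₁ (e , refl) | inj₁ (f , refl) =
      Product.map (cong pole) (cong pole) (poles-edge e f ab)
    ... | inj₁ (e , refl) | inj₂ out-b      = contradiction (proj₂ (resp e b out-b) ab) (<-asym b<a)
    ... | inj₂ out-a      | inj₁ (f , refl) = contradiction (proj₁ (resp f a out-a) ab) (<-asym b<a)
    ... | inj₂ out-a      | inj₂ out-b      =
      ⊥-elim ([ out-a uEnd , [ out-a vEnd , [ out-b uEnd , out-b vEnd ]′ ]′ ]′ touches)

  module _ {p : Fin n → Fin n} (resp : RespectsPoles p) where

    after-pole⇒from-pole : ∀ {e w} → Outside w → p (pole e) < p w → adj (pole e) w ≡ true
    after-pole⇒from-pole {e} {w} out e<w with adj (pole e) w in e→w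
    ... | true  = refl
    ... | false =
      contradiction (proj₁ (resp e w out) (reverse tour (≢-sym (out e)) e→w)) (<-asym e<w)

    before-pole⇒to-pole : ∀ {e w} → Outside w → p w < p (pole e) → adj w (pole e) ≡ true
    before-pole⇒to-pole {e} {w} out w<e with adj w (pole e) in w→e
    ... | true  = refl
    ... | false =
      contradiction (proj₂ (resp e w out) (reverse tour (out e) w→e)) (<-asym w<e)

    cut⇒cross : ∀ e {a b} → CutEdge e a b → Cross adj p (p (pole e)) a b
    cut⇒cross e {a} {b} (out-a , out-b , e→a , b→e , ab) = (<-trans b<e e<a , ab) , b<e , e<a
      where
      b<e : p b < p (pole e)
      b<e = proj₁ (resp e b out-b) b→e
      e<a : p (pole e) < p a
      e<a = proj₂ (resp e a out-a) e→a

    cross-outside : p v < p u → ∀ e {a b} → Cross adj p (p (pole e)) a b → Outside a × Outside b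
    cross-outside v<u uEnd {a} {b} ((_ , ab) , b<u , u<a) = out-a , out-b
      where
      out-a : Outside a
      out-a = outside (λ a≡u → <-irrefl (cong p (sym a≡u)) u<a)
                      (λ a≡v → <-asym v<u (subst (λ x → p u < p x) a≡v u<a))
      out-b : Outside b
      out-b = outside (λ b≡u → <-irrefl (cong p b≡u) b<u)
                      (λ b≡v → <-asym u<a (<-trans (proj₁ (resp vEnd a out-a)
                                 (subst (λ x → adj a x ≡ true) b≡v ab)) v<u))
    cross-outside v<u vEnd {a} {b} ((_ , ab) , b<v , v<a) = out-a , out-b
      where
      out-b : Outside b
      out-b = outside (λ b≡u → <-asym v<u (subst (λ x → p x < p v) b≡u b<v))
                      (λ b≡v → <-irrefl (cong p b≡v) b<v)
      out-a : Outside a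
      out-a = outside (λ a≡u → <-asym b<v (<-trans v<u (proj₂ (resp uEnd b out-b)
                                 (subst (λ x → adj x b ≡ true) a≡u ab))))
                      (λ a≡v → <-irrefl (cong p (sym a≡v)) v<a)

    cross⇒cut : p v < p u → ∀ e {a b} → Cross adj p (p (pole e)) a b → CutEdge e a b
    cross⇒cut v<u e {a} {b} cross@((_ , ab) , b<e , e<a) =
      out-a , out-b , after-pole⇒from-pole out-a e<a , before-pole⇒to-pole out-b b<e , ab
      where
      out-a : Outside a
      out-a = proj₁ (cross-outside v<u e cross)
      out-b : Outside b
      out-b = proj₂ (cross-outside v<u e cross)

  module Canonical (nm : NoMiddle) where

    rank : Fin n → Fin 5
    rank w with pole? w
    ... | inj₁ (e , _) = pole-slot e
    ... | inj₂ out     = profile-slot (proj₁ (profile-of nm w out))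

    rank-pole : ∀ e → rank (pole e) ≡ pole-slot e
    rank-pole e with pole? (pole e)
    ... | inj₁ (f , e≡f) = cong pole-slot (pole-injective (sym e≡f))
    ... | inj₂ out       = contradiction refl (out e)

    rank-outside : ∀ {w} → Outside w → ∃ λ k → HasProfile w k × rank w ≡ profile-slot k
    rank-outside {w} out with pole? w
    ... | inj₁ (e , w≡e) = contradiction w≡e (out e)
    ... | inj₂ out′      = _ , proj₂ (profile-of nm w out′) , refl

    key : Fin n → Fin (5 ℕ.* n)
    key w = combine (rank w) w

    key-injective : Injective _≡_ _≡_ key
    key-injective {a} {b} = combine-injectiveʳ (rank a) a (rank b) b

    open Ranking key key-injective public using (position; position-injective)

    rank-mono : ∀ {a b} → rank a < rank b → position a < position b
    rank-mono {a} {b} lt = Ranking.position-mono key key-injective {a} {b} (combine-monoˡ-< a b lt)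

    v<u : position v < position u
    v<u = rank-mono {v} {u} (subst₂ _<_ (sym (rank-pole vEnd)) (sym (rank-pole uEnd)) (ℕ.s<s ℕ.z<s))

    respects : RespectsPoles position
    respects e w out with rank-outside out
    ... | k , has , rank≡ = before , after
      where
      before : adj w (pole e) ≡ true → position w < position (pole e)
      before w→e = rank-mono {w} {pole e} (subst₂ _<_ (sym rank≡) (sym (rank-pole e))
                     (slot-before e k (trans (sym (has e)) w→e)))
      after : adj (pole e) w ≡ true → position (pole e) < position w
      after e→w = rank-mono {pole e} {w} (subst₂ _<_ (sym (rank-pole e)) (sym rank≡)
                    (slot-after e k (trans (sym (has e)) (edge⇒non-edge tour e→w))))

  bridge⇔ : Bridge adj u v ⇔ (NoMiddle × ∀ e → MatchingAt e)
  bridge⇔ = mk⇔ to from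
    where
    to : Bridge adj u v → NoMiddle × ∀ e → MatchingAt e
    to (p , p-injective , v<u , isolated , at-u , at-v) =
      respects⇒no-middle resp v<u ,
      λ { uEnd → IsMatching-antimono (cut⇒cross resp uEnd) at-u
        ; vEnd → IsMatching-antimono (cut⇒cross resp vEnd) at-v }
      where
      resp : RespectsPoles p
      resp = isolated⇒respects p-injective isolated

    from : NoMiddle × (∀ e → MatchingAt e) → Bridge adj u v
    from (nm , match) =
      position , position-injective , v<u , respects⇒isolated respects v<u ,
      IsMatching-antimono (cross⇒cut respects v<u uEnd) (match uEnd) ,
      IsMatching-antimono (cross⇒cut respects v<u vEnd) (match vEnd)
      where open Canonical nm

lemma3p7 : {n : ℕ} (adj : Adj (Fin n)) → IsTournament adj → Free adj Δ122 →
    (u v : Fin n) → adj u v ≡ true →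
    ((Free (join adj u v) Δ122 × ¬ Nested adj u v) ⇔ Bridge adj u v)
lemma3p7 adj tour T-free u v uv = mk⇔
  (λ { (J-free , not-nested) →
         from bridge⇔ (to not-nested⇔no-middle not-nested , Δ122-free⇒matching J-free) })
  (λ bridge → let nm , match = to bridge⇔ bridge in
     matching⇒Δ122-free T-free nm match , from not-nested⇔no-middle nm)
  where
  open Join adj tour uv
  open Equivalence
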